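{- Let $T$ be a string and $a$ a character. For every $y \in \mathrm{Substr}(T)$ with $y \in \mathsf{M}(T)$ and $y \in \mathsf{M}(aT)$, we have $d_{aT}(y) \in \{d_T(y), d_T(y)+1\}$. Moreover, there is at most one such $y$ with $d_{aT}(y) = d_T(y)+1$. Consequently $G(T) \leq 1$, where $G(T) = \sum_{y \in \mathsf{M}(T) \cap \mathsf{M}(aT)} \max\{0, d_{aT}(y) - d_T(y)\}$ is the total number of new outgoing edges of nodes of $\mathrm{CDAWG}(T)$ that remain nodes in $\mathrm{CDAWG}(aT)$.
   Context: Strings are finite sequences of characters from an alphabet $\Sigma$; $\varepsilon$ is the empty string. For a string $T$, $\mathrm{Substr}(T)$ is its set of substrings (including $\varepsilon$). A substring $u$ of $T$ is left-maximal in $T$ if $u$ is a prefix of $T$ or there are distinct characters $c \neq d$ with $cu, du \in \mathrm{Substr}(T)$; it is right-maximal in $T$ if $u$ is a suffix of $T$ or there are distinct characters $c\neq d$ with $uc, ud \in \mathrm{Substr}(T)$. $\mathsf{M}(T)$ is the set of substrings of $T$ that are both left- and right-maximal; these are the nodes of the CDAWG of $T$. For a string $w$, $d_T(w)$ is the number of distinct characters $c$ with $wc \in \mathrm{Substr}(T)$ (for $w\in\mathsf{M}(T)$, the out-degree of $w$ in the CDAWG of $T$). -}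

module Defs where

open import Data.List using (List; []; _∷_; _++_; [_]; length; filter; deduplicate)
open import Data.Product using (∃; ∃₂; _×_; _,_)
open import Data.Sum using (_⊎_)
open import Data.Nat using (ℕ)
open import Relation.Nullary using (¬_)
open import Relation.Binary.PropositionalEquality using (_≡_)
open import Relation.Binary.Definitions using (DecidableEquality)
open import Data.List.Relation.Binary.Infix.Heterogeneous using (Infix)
open import Data.List.Relation.Binary.Infix.Heterogeneous.Properties using (infix?)
open import Data.List.Relation.Binary.Prefix.Heterogeneous using (Prefix)
open import Data.List.Relation.Binary.Suffix.Heterogeneous using (Suffix)

module _ {A : Set} where

  Substr : List A → List A → Set
  Substr T u = Infix _≡_ u T

  IsPrefix : List A → List A → Set
  IsPrefix T u = Prefix _≡_ u T

  IsSuffix : List A → List A → Set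
  IsSuffix T u = Suffix _≡_ u T

  LeftMaximal : List A → List A → Set
  LeftMaximal T u =
    IsPrefix T u ⊎
    (∃₂ λ (c d : A) → ¬ (c ≡ d) × Substr T (c ∷ u) × Substr T (d ∷ u))

  RightMaximal : List A → List A → Set
  RightMaximal T u =
    IsSuffix T u ⊎
    (∃₂ λ (c d : A) → ¬ (c ≡ d) × Substr T (u ++ [ c ]) × Substr T (u ++ [ d ]))

  M : List A → List A → Set
  M T u = Substr T u × LeftMaximal T u × RightMaximal T u

  -- d_T(w): number of distinct characters c with wc ∈ Substr(T).
  -- Every such c occurs in T, so we collect the characters of T that qualify
  -- and remove duplicates.
  d : DecidableEquality A → List A → List A → ℕ
  d _≟_ T w = length (deduplicate _≟_ (filter (λ c → infix? _≟_ (w ++ [ c ]) T) T))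

-- A character c that extends y in aT but not in T can only come from the first position
-- of aT: y ∷ʳ c is a prefix of aT.  For fixed y this c is unique, so d grows by at most
-- one.  Two substrings y, z of T cannot both gain a character: of the two prefixes
-- y ∷ʳ c and z ∷ʳ c′ of aT, the shorter one would otherwise be a prefix of the stem of
-- the longer one, hence itself a substring of T.
module Submission where

open import Defs
open import Data.List using (List; []; _∷_; map; _++_; [_]; _∷ʳ_; length; filter; deduplicate; take; drop)
open import Data.List.Properties using (length-++; length-take; length-removeAt′; ∷ʳ-injectiveˡ)
open import Data.Nat.ListAction using (sum)
open import Data.List.Relation.Unary.All as All using (All)
open import Data.List.Relation.Unary.Any using (here; there; any?)
open import Data.List.Relation.Unary.AllPairs using (_∷_)
open import Data.List.Relation.Unary.Unique.Propositional using (Unique; [])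
open import Data.List.Relation.Unary.Unique.DecPropositional.Properties using (deduplicate-!)
open import Data.List.Relation.Binary.Subset.Propositional using (_⊆_)
open import Data.List.Membership.Propositional using (_∈_; _∉_; _─_; find; lose)
open import Data.List.Membership.Propositional.Properties
  using (∈-filter⁺; ∈-filter⁻; ∈-deduplicate⁺; ∈-deduplicate⁻; ∈-++⁺ˡ; ∈-++⁺ʳ)
import Data.List.Membership.DecPropositional as DecMembership
open import Data.List.Relation.Binary.Prefix.Heterogeneous using (Prefix; []; _∷_)
open import Data.List.Relation.Binary.Infix.Heterogeneous using (Infix; here; there)
open import Data.List.Relation.Binary.Infix.Heterogeneous.Properties using (infix?; Prefix-Infix-trans)
open import Data.Nat using (ℕ; suc; _∸_; _≤_; _<_; _+_; z≤n; s≤s; _<?_)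
open import Data.Nat.Properties
  using (≤-refl; ≤-trans; ≤-reflexive; ≤-antisym; +-mono-≤; +-comm; m⊓n≤m; <⇒≱; >⇒≢; ≮⇒≥; n≤0⇒n≡0;
         m≤n⇒m<n∨m≡n; m≤n+o⇒m∸n≤o; m∸n≢0⇒n<m; module ≤-Reasoning)
open import Data.Product using (_×_; _,_; ∃; proj₁; proj₂)
open import Data.Sum using (_⊎_; inj₁; inj₂)
import Data.Sum as Sum
open import Data.Empty using (⊥-elim)
open import Relation.Nullary using (¬_; yes; no; contradiction)
open import Relation.Nullary.Decidable using (decidable-stable)
open import Relation.Binary.PropositionalEquality using (_≡_; _≢_; refl; sym; trans; cong)
open import Relation.Binary.Definitions using (DecidableEquality)
open import Function using (_∘_)

module _ {A : Set} where

  ∈-─ : ∀ {x z : A} {ys} → z ∈ ys → z ≢ x → (x∈ys : x ∈ ys) → z ∈ ys ─ x∈ys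
  ∈-─ (here refl) z≢x (here refl) = ⊥-elim (z≢x refl)
  ∈-─ (here refl) z≢x (there _)   = here refl
  ∈-─ (there z∈)  z≢x (here refl) = z∈
  ∈-─ (there z∈)  z≢x (there x∈)  = there (∈-─ z∈ z≢x x∈)

  Unique-⊆⇒length-≤ : ∀ {xs ys : List A} → Unique xs → xs ⊆ ys → length xs ≤ length ys
  Unique-⊆⇒length-≤ {[]}          []         xs⊆ys = z≤n
  Unique-⊆⇒length-≤ {x ∷ xs} {ys} (x∉xs ∷ u) xs⊆ys = begin
    suc (length xs)          ≤⟨ s≤s (Unique-⊆⇒length-≤ u xs⊆ys─x) ⟩
    suc (length (ys ─ x∈ys)) ≡⟨ sym (length-removeAt′ ys _) ⟩
    length ys                ∎
    where
    open ≤-Reasoning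
    x∈ys : x ∈ ys
    x∈ys = xs⊆ys (here refl)
    xs⊆ys─x : xs ⊆ ys ─ x∈ys
    xs⊆ys─x z∈xs = ∈-─ (xs⊆ys (there z∈xs)) (λ z≡x → All.lookup x∉xs z∈xs (sym z≡x)) x∈ys

  Prefix⇒⊆ : ∀ {u v : List A} → Prefix _≡_ u v → u ⊆ v
  Prefix⇒⊆ (refl ∷ _) (here refl) = here refl
  Prefix⇒⊆ (refl ∷ p) (there x∈u) = there (Prefix⇒⊆ p x∈u)

  Infix⇒⊆ : ∀ {u v : List A} → Infix _≡_ u v → u ⊆ v
  Infix⇒⊆ (here p)  = Prefix⇒⊆ p
  Infix⇒⊆ (there p) x∈u = there (Infix⇒⊆ p x∈u)

  Prefix-∷ʳ⁻ : ∀ {u : List A} {c} z → Prefix _≡_ u (z ∷ʳ c) → Prefix _≡_ u z ⊎ u ≡ z ∷ʳ c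
  Prefix-∷ʳ⁻ []      []         = inj₁ []
  Prefix-∷ʳ⁻ []      (refl ∷ []) = inj₂ refl
  Prefix-∷ʳ⁻ (_ ∷ _) []         = inj₁ []
  Prefix-∷ʳ⁻ (x ∷ z) (refl ∷ p) = Sum.map (refl ∷_) (cong (x ∷_)) (Prefix-∷ʳ⁻ z p)

  Prefix-comparable : ∀ {u v xs : List A} → Prefix _≡_ u xs → Prefix _≡_ v xs →
                      Prefix _≡_ u v ⊎ Prefix _≡_ v u
  Prefix-comparable []         _          = inj₁ []
  Prefix-comparable (_ ∷ _)    []         = inj₂ []
  Prefix-comparable (refl ∷ p) (refl ∷ q) = Sum.map (refl ∷_) (refl ∷_) (Prefix-comparable p q)

  next : List A → List A → List A
  next y xs = take 1 (drop (length y) xs)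

  length-next≤1 : ∀ y xs → length (next y xs) ≤ 1
  length-next≤1 y xs = ≤-trans (≤-reflexive (length-take 1 (drop (length y) xs))) (m⊓n≤m 1 _)

  Prefix-∷ʳ⇒∈-next : ∀ y {c} {xs : List A} → Prefix _≡_ (y ∷ʳ c) xs → c ∈ next y xs
  Prefix-∷ʳ⇒∈-next []      (refl ∷ _) = here refl
  Prefix-∷ʳ⇒∈-next (_ ∷ y) (_ ∷ p)    = Prefix-∷ʳ⇒∈-next y p

  stem-≡-of-nested-new-prefix : ∀ {y z T : List A} {c c′} → Prefix _≡_ (y ∷ʳ c) (z ∷ʳ c′) →
                   Infix _≡_ z T → ¬ Infix _≡_ (y ∷ʳ c) T → y ≡ z
  stem-≡-of-nested-new-prefix {y} {z} p z⊑T yc⋢T with Prefix-∷ʳ⁻ z p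
  ... | inj₁ yc≤z = contradiction (Prefix-Infix-trans trans yc≤z z⊑T) yc⋢T
  ... | inj₂ yc≡zc′ = ∷ʳ-injectiveˡ y z yc≡zc′

  unique-stem-of-new-prefix : ∀ {y z T xs : List A} {c c′} →
    Prefix _≡_ (y ∷ʳ c) xs → Prefix _≡_ (z ∷ʳ c′) xs → Infix _≡_ y T → Infix _≡_ z T →
    ¬ Infix _≡_ (y ∷ʳ c) T → ¬ Infix _≡_ (z ∷ʳ c′) T → y ≡ z
  unique-stem-of-new-prefix yc≤xs zc′≤xs y⊑T z⊑T yc⋢T zc′⋢T
    with Prefix-comparable yc≤xs zc′≤xs
  ... | inj₁ yc≤zc′ = stem-≡-of-nested-new-prefix yc≤zc′ z⊑T yc⋢T
  ... | inj₂ zc′≤yc = sym (stem-≡-of-nested-new-prefix zc′≤yc y⊑T zc′⋢T)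

module _ {B : Set} (f : B → ℕ) where

  sum-map-≡0 : ∀ {L : List B} → (∀ {x} → x ∈ L → f x ≡ 0) → sum (map f L) ≡ 0
  sum-map-≡0 {[]}    _    = refl
  sum-map-≡0 {x ∷ L} all0 rewrite all0 (here refl) = sum-map-≡0 (all0 ∘ there)

  sum-map-≤1 : ∀ {L : List B} → Unique L → (∀ {x} → x ∈ L → f x ≤ 1) →
               (∀ {x z} → x ∈ L → z ∈ L → 0 < f x → 0 < f z → x ≡ z) →
               sum (map f L) ≤ 1
  sum-map-≤1 {[]}    _          _   _        = z≤n
  sum-map-≤1 {x ∷ L} (x∉L ∷ u) ≤1 only-one with 0 <? f x
  ... | no  fx≮0 = +-mono-≤ (≮⇒≥ fx≮0) (sum-map-≤1 u (≤1 ∘ there) (λ p q → only-one (there p) (there q)))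
  ... | yes fx>0 = +-mono-≤ (≤1 (here refl)) (≤-reflexive (sum-map-≡0 rest≡0))
    where
    rest≡0 : ∀ {z} → z ∈ L → f z ≡ 0
    rest≡0 {z} z∈L with 0 <? f z
    ... | no  fz≮0 = n≤0⇒n≡0 (≮⇒≥ fz≮0)
    ... | yes fz>0 = contradiction (only-one (here refl) (there z∈L) fx>0 fz>0) (All.lookup x∉L z∈L)

module _ {A : Set} (_≟_ : DecidableEquality A) where
  open DecMembership _≟_ using (_∈?_; _∉?_)

  ⊆-or-∃∉ : (xs ys : List A) → xs ⊆ ys ⊎ ∃ λ c → c ∈ xs × c ∉ ys
  ⊆-or-∃∉ xs ys with any? (_∉? ys) xs
  ... | yes some∉ = inj₂ (find some∉)
  ... | no  none∉ = inj₁ λ {c} c∈xs → decidable-stable (c ∈? ys) (none∉ ∘ lose c∈xs)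

  extensions : List A → List A → List A
  extensions T w = deduplicate _≟_ (filter (λ c → infix? _≟_ (w ++ [ c ]) T) T)

  extensions-unique : ∀ T w → Unique (extensions T w)
  extensions-unique T w = deduplicate-! _≟_ (filter (λ c → infix? _≟_ (w ++ [ c ]) T) T)

  ∈-extensions⁺ : ∀ {T w c} → Substr T (w ∷ʳ c) → c ∈ extensions T w
  ∈-extensions⁺ {T} {w} wc⊑T = ∈-deduplicate⁺ _≟_
    (∈-filter⁺ (λ c → infix? _≟_ (w ++ [ c ]) T) (Infix⇒⊆ wc⊑T (∈-++⁺ʳ w (here refl))) wc⊑T)

  ∈-extensions⁻ : ∀ {T w c} → c ∈ extensions T w → Substr T (w ∷ʳ c)
  ∈-extensions⁻ {T} {w} c∈ =
    proj₂ (∈-filter⁻ (λ c → infix? _≟_ (w ++ [ c ]) T) {xs = T} (∈-deduplicate⁻ _≟_ _ c∈))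

  ∈-extensions-∷⁻ : ∀ {a T y c} → c ∈ extensions (a ∷ T) y →
                    Prefix _≡_ (y ∷ʳ c) (a ∷ T) ⊎ c ∈ extensions T y
  ∈-extensions-∷⁻ c∈ with ∈-extensions⁻ c∈
  ... | here  yc≤aT = inj₁ yc≤aT
  ... | there yc⊑T  = inj₂ (∈-extensions⁺ yc⊑T)

  d-∷-≥ : ∀ T a y → d _≟_ T y ≤ d _≟_ (a ∷ T) y
  d-∷-≥ T a y = Unique-⊆⇒length-≤ (extensions-unique T y) ext⊆ext
    where
    ext⊆ext : extensions T y ⊆ extensions (a ∷ T) y
    ext⊆ext c∈ = ∈-extensions⁺ (there (∈-extensions⁻ {T} {y} c∈))

  d-∷-≤ : ∀ T a y → d _≟_ (a ∷ T) y ≤ suc (d _≟_ T y)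
  d-∷-≤ T a y = begin
    length (extensions (a ∷ T) y)             ≤⟨ Unique-⊆⇒length-≤ (extensions-unique (a ∷ T) y) ⊆next++ext ⟩
    length (next y (a ∷ T) ++ extensions T y) ≡⟨ length-++ (next y (a ∷ T)) ⟩
    length (next y (a ∷ T)) + d _≟_ T y       ≤⟨ +-mono-≤ (length-next≤1 y (a ∷ T)) ≤-refl ⟩
    suc (d _≟_ T y)                           ∎
    where
    open ≤-Reasoning
    ⊆next++ext : extensions (a ∷ T) y ⊆ next y (a ∷ T) ++ extensions T y
    ⊆next++ext c∈ with ∈-extensions-∷⁻ c∈
    ... | inj₁ yc≤aT = ∈-++⁺ˡ (Prefix-∷ʳ⇒∈-next y yc≤aT)
    ... | inj₂ c∈T   = ∈-++⁺ʳ (next y (a ∷ T)) c∈T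

  new-extension : ∀ T a y → d _≟_ T y < d _≟_ (a ∷ T) y →
                  ∃ λ c → Prefix _≡_ (y ∷ʳ c) (a ∷ T) × ¬ Substr T (y ∷ʳ c)
  new-extension T a y d< with ⊆-or-∃∉ (extensions (a ∷ T) y) (extensions T y)
  ... | inj₁ ⊆ext = contradiction (Unique-⊆⇒length-≤ (extensions-unique (a ∷ T) y) ⊆ext) (<⇒≱ d<)
  ... | inj₂ (c , c∈ , c∉) with ∈-extensions-∷⁻ c∈
  ...   | inj₁ yc≤aT = c , yc≤aT , c∉ ∘ ∈-extensions⁺
  ...   | inj₂ c∈T   = contradiction c∈T c∉

  d-∷-≡⊎≡suc : ∀ T a y → d _≟_ (a ∷ T) y ≡ d _≟_ T y ⊎ d _≟_ (a ∷ T) y ≡ suc (d _≟_ T y)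
  d-∷-≡⊎≡suc T a y with m≤n⇒m<n∨m≡n (d-∷-≤ T a y)
  ... | inj₁ (s≤s d≤) = inj₁ (≤-antisym d≤ (d-∷-≥ T a y))
  ... | inj₂ d≡suc    = inj₂ d≡suc

  d-∷-∸≤1 : ∀ T a y → d _≟_ (a ∷ T) y ∸ d _≟_ T y ≤ 1
  d-∷-∸≤1 T a y = m≤n+o⇒m∸n≤o _ (d _≟_ T y) (≤-trans (d-∷-≤ T a y) (≤-reflexive (+-comm 1 _)))

  growing-substr-unique : ∀ {T a y z} → Substr T y → Substr T z →
    d _≟_ T y < d _≟_ (a ∷ T) y → d _≟_ T z < d _≟_ (a ∷ T) z → y ≡ z
  growing-substr-unique {T} {a} {y} {z} y⊑T z⊑T y-grows z-grows
    with new-extension T a y y-grows | new-extension T a z z-grows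
  ... | c , yc≤aT , yc⋢T | c′ , zc′≤aT , zc′⋢T =
    unique-stem-of-new-prefix yc≤aT zc′≤aT y⊑T z⊑T yc⋢T zc′⋢T

  total-growth≤1 : ∀ T a {L : List (List A)} → Unique L → All (Substr T) L →
                   sum (map (λ y → d _≟_ (a ∷ T) y ∸ d _≟_ T y) L) ≤ 1
  total-growth≤1 T a u substrs = sum-map-≤1 (λ y → d _≟_ (a ∷ T) y ∸ d _≟_ T y) u
    (λ {y} _ → d-∷-∸≤1 T a y)
    (λ y∈L z∈L y-grows z-grows →
      growing-substr-unique (All.lookup substrs y∈L) (All.lookup substrs z∈L)
        (m∸n≢0⇒n<m (>⇒≢ y-grows)) (m∸n≢0⇒n<m (>⇒≢ z-grows)))

lemma5 : {A : Set} (_≟_ : DecidableEquality A) (T : List A) (a : A) →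
    ((y : List A) → Substr T y → M T y → M (a ∷ T) y →
      (d _≟_ (a ∷ T) y ≡ d _≟_ T y) ⊎ (d _≟_ (a ∷ T) y ≡ suc (d _≟_ T y)))
    ×
    ((y z : List A) → M T y → M (a ∷ T) y → M T z → M (a ∷ T) z →
      d _≟_ (a ∷ T) y ≡ suc (d _≟_ T y) →
      d _≟_ (a ∷ T) z ≡ suc (d _≟_ T z) →
      y ≡ z)
    ×
    ((L : List (List A)) → Unique L →
      All (λ y → M T y × M (a ∷ T) y) L →
      sum (map (λ y → d _≟_ (a ∷ T) y ∸ d _≟_ T y) L) ≤ 1)
lemma5 _≟_ T a =
    (λ y _ _ _ → d-∷-≡⊎≡suc _≟_ T a y)
  , (λ y z (y⊑T , _) _ (z⊑T , _) _ y-grows z-grows →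
       growing-substr-unique _≟_ y⊑T z⊑T (≤-reflexive (sym y-grows)) (≤-reflexive (sym z-grows)))
  , (λ L u nodes → total-growth≤1 _≟_ T a u (All.map (proj₁ ∘ proj₁) nodes))
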